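{- $D_4(0)=1$, $D_4(1)=6$, $D_4(2n+1)=6D_4(n)$ for all $n\ge 0$, and $D_4(2n+2)=D_4(n+1)+D_4(n)$ for all $n\ge 0$.
   Context: A P-position of the game of Nim with $k$ piles is a $k$-tuple $(p_1,\dots,p_k)$ of non-negative integers whose nim-sum $p_1\oplus\cdots\oplus p_k$ is $0$, where $\oplus$ denotes bitwise XOR. $D_k(n)$ denotes the number of P-positions with $k$ piles whose total number of counters equals exactly $2n$. -}

module Defs where

open import Data.Nat using (ℕ; zero; suc; _+_; _*_; _%_; _/_; _≡ᵇ_)
open import Data.Bool using (Bool; true; false; if_then_else_)
open import Data.List using (List; []; _∷_; concatMap; map; filterᵇ; length; upTo; foldr; sum)
open import Data.Vec using (Vec)

-- The fuel argument bounds the number of bits processed; fuel m + n suffices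
-- since each step halves both arguments (a number x has at most x bits).
xorFuel : ℕ → ℕ → ℕ → ℕ
xorFuel zero    m n = 0
xorFuel (suc f) m n =
  (if (m % 2) ≡ᵇ (n % 2) then 0 else 1) + 2 * xorFuel f (m / 2) (n / 2)

_⊕_ : ℕ → ℕ → ℕ
m ⊕ n = xorFuel (m + n) m n

infixl 6 _⊕_

nimSum : List ℕ → ℕ
nimSum = foldr _⊕_ 0

compositions : ℕ → ℕ → List (List ℕ)
compositions zero    zero    = [] ∷ []
compositions zero    (suc t) = []
compositions (suc k) t =
  concatMap (λ i → map (i ∷_) (compositions k (t ∸' i))) (upTo (suc t))
  where
  _∸'_ : ℕ → ℕ → ℕ
  a ∸' b = Data.Nat._∸_ a b

-- D k n : number of P-positions of k-pile Nim (nim-sum 0) with total exactly 2n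
D : ℕ → ℕ → ℕ
D k n = length (filterᵇ (λ p → nimSum p ≡ᵇ 0) (compositions k (2 * n)))

-- Write each pile as p = b + 2q with a low bit b.  The nim-sum of the
-- piles is then (parity of the bits) + 2·(nim-sum of the halves), so a
-- position is a P-position iff its bits have even parity and its halves
-- form a P-position.  Among the 16 bit vectors of length 4, the even ones
-- have 0, 2 or 4 ones with multiplicities 1, 6, 1.  Writing c(t) for the
-- number of 4-pile P-positions of total t, this gives c(odd) = 0 and
-- c(2u) = c(u) + 6 c(u - 1) + c(u - 2) for u ≥ 2, and D₄(n) = c(2n).
-- To decouple the piles, sums over compositions are rewritten as sums
-- over a box [0, M)⁴ weighted by the indicator of the total.
module Submission where

open import Defs
open import Data.Bool using (Bool; true; false; if_then_else_; not; _xor_)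
open import Data.List using (List; []; _∷_; map; filterᵇ; length; applyUpTo; upTo; concatMap; _++_; foldr)
open import Data.List.Properties using (map-++; map-∘)
open import Data.Nat using (ℕ; zero; suc; _+_; _*_; _∸_; _≤_; _<_; z≤n; s≤s; s≤s⁻¹; _%_; _/_; _≡ᵇ_)
open import Data.Nat.DivMod using (m/n<m; m/n≤m; %-remove-+ʳ; +-distrib-/-∣ʳ; /-congˡ; m*n/n≡m)
open import Data.Nat.Divisibility using (m∣m*n)
open import Data.Nat.ListAction using (sum)
open import Data.Nat.ListAction.Properties using (sum-++)
open import Data.Nat.Properties
open import Data.Nat.Tactic.RingSolver using (solve-∀)
open import Data.Product using (_×_; _,_)
open import Relation.Binary.PropositionalEquality
open ≡-Reasoning

⟦_⟧ : Bool → ℕ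
⟦ true ⟧  = 1
⟦ false ⟧ = 0

length-filterᵇ : ∀ {A : Set} (P : A → Bool) xs →
                 length (filterᵇ P xs) ≡ sum (map (λ x → ⟦ P x ⟧) xs)
length-filterᵇ P []       = refl
length-filterᵇ P (x ∷ xs) with P x
... | true  = cong suc (length-filterᵇ P xs)
... | false = length-filterᵇ P xs

∑< : ℕ → (ℕ → ℕ) → ℕ
∑< zero    g = 0
∑< (suc n) g = g 0 + ∑< n (λ i → g (suc i))

∑<-cong : ∀ n {g h} → (∀ i → i < n → g i ≡ h i) → ∑< n g ≡ ∑< n h
∑<-cong zero    e = refl
∑<-cong (suc n) e = cong₂ _+_ (e 0 (s≤s z≤n)) (∑<-cong n (λ i i<n → e (suc i) (s≤s i<n)))

∑<-zero : ∀ n {g} → (∀ i → g i ≡ 0) → ∑< n g ≡ 0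
∑<-zero zero    e = refl
∑<-zero (suc n) e = cong₂ _+_ (e 0) (∑<-zero n (λ i → e (suc i)))

∑<-distrib-+ : ∀ n g h → ∑< n (λ i → g i + h i) ≡ ∑< n g + ∑< n h
∑<-distrib-+ zero    g h = refl
∑<-distrib-+ (suc n) g h =
  trans (cong (g 0 + h 0 +_) (∑<-distrib-+ n _ _)) (+-+-interchange (g 0) (h 0) _ _)
  where
  +-+-interchange : ∀ a b c d → (a + b) + (c + d) ≡ (a + c) + (b + d)
  +-+-interchange = solve-∀

∑<-*ˡ : ∀ n c g → ∑< n (λ i → c * g i) ≡ c * ∑< n g
∑<-*ˡ zero    c g = sym (*-zeroʳ c)
∑<-*ˡ (suc n) c g = trans (cong (c * g 0 +_) (∑<-*ˡ n c _)) (sym (*-distribˡ-+ c (g 0) _))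

∑<-extend : ∀ {n M} g → n ≤ M → (∀ i → n ≤ i → g i ≡ 0) → ∑< n g ≡ ∑< M g
∑<-extend {M = M} g z≤n      vanish = sym (∑<-zero M (λ i → vanish i z≤n))
∑<-extend         g (s≤s le) vanish =
  cong (g 0 +_) (∑<-extend (λ i → g (suc i)) le (λ i n≤i → vanish (suc i) (s≤s n≤i)))

∑<-double : ∀ M g → ∑< (2 * M) g ≡ ∑< M (λ y → g (2 * y) + g (1 + 2 * y))
∑<-double zero    g = refl
∑<-double (suc M) g = begin
  g 0 + ∑< (M + suc (M + 0)) (λ i → g (suc i))
    ≡⟨ cong (λ n → g 0 + ∑< n (λ i → g (suc i))) (+-suc M (M + 0)) ⟩
  g 0 + (g 1 + ∑< (2 * M) (λ i → g (2 + i)))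
    ≡⟨ cong (λ s → g 0 + (g 1 + s)) (∑<-double M _) ⟩
  g 0 + (g 1 + ∑< M (λ y → g (2 + 2 * y) + g (3 + 2 * y)))
    ≡⟨ sym (+-assoc (g 0) (g 1) _) ⟩
  g 0 + g 1 + ∑< M (λ y → g (2 + 2 * y) + g (3 + 2 * y))
    ≡⟨ cong (g 0 + g 1 +_) (∑<-cong M (λ y _ →
         cong₂ _+_ (cong g (sym (*-suc 2 y))) (cong (λ x → g (suc x)) (sym (*-suc 2 y))))) ⟩
  g 0 + g 1 + ∑< M (λ y → g (2 * suc y) + g (1 + 2 * suc y)) ∎

∑□ : ℕ → ℕ → (List ℕ → ℕ) → ℕ
∑□ zero    M f = f []
∑□ (suc k) M f = ∑< M (λ x → ∑□ k M (λ p → f (x ∷ p)))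

∑□-cong : ∀ k M {f g} → (∀ p → f p ≡ g p) → ∑□ k M f ≡ ∑□ k M g
∑□-cong zero    M e = e []
∑□-cong (suc k) M e = ∑<-cong M (λ x _ → ∑□-cong k M (λ p → e (x ∷ p)))

∑□-zero : ∀ k M {f} → (∀ p → f p ≡ 0) → ∑□ k M f ≡ 0
∑□-zero zero    M e = e []
∑□-zero (suc k) M e = ∑<-zero M (λ x → ∑□-zero k M (λ p → e (x ∷ p)))

∑□-distrib-+ : ∀ k M f g → ∑□ k M (λ p → f p + g p) ≡ ∑□ k M f + ∑□ k M g
∑□-distrib-+ zero    M f g = refl
∑□-distrib-+ (suc k) M f g =
  trans (∑<-cong M (λ x _ → ∑□-distrib-+ k M _ _)) (∑<-distrib-+ M _ _)

∑□-*ˡ : ∀ k M c f → ∑□ k M (λ p → c * f p) ≡ c * ∑□ k M f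
∑□-*ˡ zero    M c f = refl
∑□-*ˡ (suc k) M c f = trans (∑<-cong M (λ x _ → ∑□-*ˡ k M c _)) (∑<-*ˡ M c _)

sum-map-concatMap : ∀ {A B : Set} (f : B → ℕ) (g : A → List B) xs →
  sum (map f (concatMap g xs)) ≡ sum (map (λ x → sum (map f (g x))) xs)
sum-map-concatMap f g []       = refl
sum-map-concatMap f g (x ∷ xs) = begin
  sum (map f (g x ++ concatMap g xs))            ≡⟨ cong sum (map-++ f (g x) _) ⟩
  sum (map f (g x) ++ map f (concatMap g xs))    ≡⟨ sum-++ (map f (g x)) _ ⟩
  sum (map f (g x)) + sum (map f (concatMap g xs)) ≡⟨ cong (_ +_) (sum-map-concatMap f g xs) ⟩
  sum (map f (g x)) + sum (map (λ x → sum (map f (g x))) xs) ∎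

sum-map-applyUpTo : ∀ (g h : ℕ → ℕ) n → sum (map g (applyUpTo h n)) ≡ ∑< n (λ i → g (h i))
sum-map-applyUpTo g h zero    = refl
sum-map-applyUpTo g h (suc n) = cong (g (h 0) +_) (sum-map-applyUpTo g (λ i → h (suc i)) n)

sum-map-compositions-suc : ∀ k t (f : List ℕ → ℕ) →
  sum (map f (compositions (suc k) t))
    ≡ ∑< (suc t) (λ i → sum (map (λ p → f (i ∷ p)) (compositions k (t ∸ i))))
sum-map-compositions-suc k t f = begin
  sum (map f (concatMap (λ i → map (i ∷_) (compositions k (t ∸ i))) (upTo (suc t))))
    ≡⟨ sum-map-concatMap f (λ i → map (i ∷_) (compositions k (t ∸ i))) (upTo (suc t)) ⟩
  sum (map (λ i → sum (map f (map (i ∷_) (compositions k (t ∸ i))))) (upTo (suc t)))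
    ≡⟨ sum-map-applyUpTo _ (λ i → i) (suc t) ⟩
  ∑< (suc t) (λ i → sum (map f (map (i ∷_) (compositions k (t ∸ i)))))
    ≡⟨ ∑<-cong (suc t) (λ i _ → cong sum (sym (map-∘ {g = f} {f = i ∷_} (compositions k (t ∸ i))))) ⟩
  ∑< (suc t) (λ i → sum (map (λ p → f (i ∷ p)) (compositions k (t ∸ i)))) ∎

+≡ᵇ-∸ : ∀ x t s → x ≤ t → (x + s ≡ᵇ t) ≡ (s ≡ᵇ t ∸ x)
+≡ᵇ-∸ zero    t       s _        = refl
+≡ᵇ-∸ (suc x) (suc t) s (s≤s le) = +≡ᵇ-∸ x t s le

+≡ᵇ-< : ∀ x t s → t < x → (x + s ≡ᵇ t) ≡ false
+≡ᵇ-< (suc x) zero    s _        = refl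
+≡ᵇ-< (suc x) (suc t) s (s≤s lt) = +≡ᵇ-< x t s lt

sum-map-compositions : ∀ k t M (f : List ℕ → ℕ) → t < M →
  sum (map f (compositions k t)) ≡ ∑□ k M (λ p → f p * ⟦ sum p ≡ᵇ t ⟧)
sum-map-compositions zero    zero    M f _  = trans (+-identityʳ (f [])) (sym (*-identityʳ (f [])))
sum-map-compositions zero    (suc t) M f _  = sym (*-zeroʳ (f []))
sum-map-compositions (suc k) t       M f lt = begin
  sum (map f (compositions (suc k) t))
    ≡⟨ sum-map-compositions-suc k t f ⟩
  ∑< (suc t) (λ i → sum (map (λ p → f (i ∷ p)) (compositions k (t ∸ i))))
    ≡⟨ ∑<-cong (suc t) (λ i i≤t → trans
         (sum-map-compositions k (t ∸ i) M (λ p → f (i ∷ p)) (≤-<-trans (m∸n≤m t i) lt))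
         (∑□-cong k M (λ p → cong (λ b → f (i ∷ p) * ⟦ b ⟧) (sym (+≡ᵇ-∸ i t (sum p) (s≤s⁻¹ i≤t)))))) ⟩
  ∑< (suc t) slice
    ≡⟨ ∑<-extend slice lt (λ i t<i → ∑□-zero k M (λ p →
         trans (cong (λ b → f (i ∷ p) * ⟦ b ⟧) (+≡ᵇ-< i t (sum p) t<i)) (*-zeroʳ (f (i ∷ p))))) ⟩
  ∑< M slice ∎
  where
  slice : ℕ → ℕ
  slice x = ∑□ k M (λ p → f (x ∷ p) * ⟦ x + sum p ≡ᵇ t ⟧)

xorFuel-zero : ∀ f → xorFuel f 0 0 ≡ 0
xorFuel-zero zero    = refl
xorFuel-zero (suc f) = cong (2 *_) (xorFuel-zero f)

halves-bound : ∀ m n f → m + n ≤ suc f → m / 2 + n / 2 ≤ f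
halves-bound zero    zero    f le = z≤n
halves-bound zero    (suc n) f le = s≤s⁻¹ (≤-trans (m/n<m (suc n) 2 (s≤s (s≤s z≤n))) le)
halves-bound (suc m) n       f le =
  s≤s⁻¹ (≤-trans (+-mono-<-≤ (m/n<m (suc m) 2 (s≤s (s≤s z≤n))) (m/n≤m n 2)) le)

xorFuel-irrelevant : ∀ f g m n → m + n ≤ f → m + n ≤ g → xorFuel f m n ≡ xorFuel g m n
xorFuel-irrelevant zero    g       zero    zero    _  _  = sym (xorFuel-zero g)
xorFuel-irrelevant (suc f) zero    zero    zero    _  _  = xorFuel-zero (suc f)
xorFuel-irrelevant (suc f) (suc g) m       n       le le′ =
  cong (λ x → (if m % 2 ≡ᵇ n % 2 then 0 else 1) + 2 * x)
       (xorFuel-irrelevant f g (m / 2) (n / 2) (halves-bound m n f le) (halves-bound m n g le′))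

⊕-unfold : ∀ m n → m ⊕ n ≡ (if m % 2 ≡ᵇ n % 2 then 0 else 1) + 2 * (m / 2 ⊕ n / 2)
⊕-unfold m n =
  trans (xorFuel-irrelevant (m + n) (suc (m + n)) m n ≤-refl (n≤1+n _))
        (cong (λ x → (if m % 2 ≡ᵇ n % 2 then 0 else 1) + 2 * x)
              (xorFuel-irrelevant (m + n) (m / 2 + n / 2) (m / 2) (n / 2)
                                  (+-mono-≤ (m/n≤m m 2) (m/n≤m n 2)) ≤-refl))

pushBit : Bool → ℕ → ℕ
pushBit b q = ⟦ b ⟧ + 2 * q

pushBit-%2 : ∀ b q → pushBit b q % 2 ≡ ⟦ b ⟧
pushBit-%2 false q = %-remove-+ʳ 0 (m∣m*n {2} q)
pushBit-%2 true  q = %-remove-+ʳ 1 (m∣m*n {2} q)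

pushBit-/2 : ∀ b q → pushBit b q / 2 ≡ q
pushBit-/2 false q =
  trans (+-distrib-/-∣ʳ 0 (m∣m*n {2} q)) (trans (/-congˡ (*-comm 2 q)) (m*n/n≡m q 2))
pushBit-/2 true  q = trans (+-distrib-/-∣ʳ 1 (m∣m*n {2} q)) (pushBit-/2 false q)

⊕-pushBit : ∀ b c a d → pushBit b a ⊕ pushBit c d ≡ pushBit (b xor c) (a ⊕ d)
⊕-pushBit b c a d = begin
  x ⊕ y
    ≡⟨ ⊕-unfold x y ⟩
  (if x % 2 ≡ᵇ y % 2 then 0 else 1) + 2 * (x / 2 ⊕ y / 2)
    ≡⟨ cong₂ _+_ (cong₂ (λ u v → if u ≡ᵇ v then 0 else 1) (pushBit-%2 b a) (pushBit-%2 c d))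
                 (cong₂ (λ u v → 2 * (u ⊕ v)) (pushBit-/2 b a) (pushBit-/2 c d)) ⟩
  (if ⟦ b ⟧ ≡ᵇ ⟦ c ⟧ then 0 else 1) + 2 * (a ⊕ d)
    ≡⟨ cong (_+ 2 * (a ⊕ d)) (bits-≡ᵇ b c) ⟩
  pushBit (b xor c) (a ⊕ d) ∎
  where
  x = pushBit b a
  y = pushBit c d
  bits-≡ᵇ : ∀ b c → (if ⟦ b ⟧ ≡ᵇ ⟦ c ⟧ then 0 else 1) ≡ ⟦ b xor c ⟧
  bits-≡ᵇ false false = refl
  bits-≡ᵇ false true  = refl
  bits-≡ᵇ true  false = refl
  bits-≡ᵇ true  true  = refl

pushBits : List Bool → List ℕ → List ℕ
pushBits []      []       = []
pushBits []      (q ∷ qs) = pushBit false q ∷ pushBits [] qs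
pushBits (b ∷ r) []       = pushBit b 0 ∷ pushBits r []
pushBits (b ∷ r) (q ∷ qs) = pushBit b q ∷ pushBits r qs

bitParity : List Bool → Bool
bitParity = foldr _xor_ false

bitCount : List Bool → ℕ
bitCount r = sum (map ⟦_⟧ r)

nimSum-pushBits : ∀ r q → nimSum (pushBits r q) ≡ pushBit (bitParity r) (nimSum q)
nimSum-pushBits []      []       = refl
nimSum-pushBits []      (q ∷ qs) =
  trans (cong (pushBit false q ⊕_) (nimSum-pushBits [] qs)) (⊕-pushBit false false q _)
nimSum-pushBits (b ∷ r) []       =
  trans (cong (pushBit b 0 ⊕_) (nimSum-pushBits r [])) (⊕-pushBit b (bitParity r) 0 0)
nimSum-pushBits (b ∷ r) (q ∷ qs) =
  trans (cong (pushBit b q ⊕_) (nimSum-pushBits r qs)) (⊕-pushBit b (bitParity r) q _)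

pushBit-+ : ∀ b q c s → pushBit b q + (c + 2 * s) ≡ (⟦ b ⟧ + c) + 2 * (q + s)
pushBit-+ b = regroup ⟦ b ⟧
  where
  regroup : ∀ x q c s → (x + 2 * q) + (c + 2 * s) ≡ (x + c) + 2 * (q + s)
  regroup = solve-∀

sum-pushBits : ∀ r q → sum (pushBits r q) ≡ bitCount r + 2 * sum q
sum-pushBits []      []       = refl
sum-pushBits []      (q ∷ qs) =
  trans (cong (pushBit false q +_) (sum-pushBits [] qs)) (pushBit-+ false q 0 _)
sum-pushBits (b ∷ r) []       =
  trans (cong (pushBit b 0 +_) (sum-pushBits r [])) (pushBit-+ b 0 _ 0)
sum-pushBits (b ∷ r) (q ∷ qs) =
  trans (cong (pushBit b q +_) (sum-pushBits r qs)) (pushBit-+ b q _ _)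

∑bits : ℕ → (List Bool → ℕ) → ℕ
∑bits zero    F = F []
∑bits (suc k) F = ∑bits k (λ r → F (false ∷ r)) + ∑bits k (λ r → F (true ∷ r))

∑bits-cong : ∀ k {F G} → (∀ r → F r ≡ G r) → ∑bits k F ≡ ∑bits k G
∑bits-cong zero    e = e []
∑bits-cong (suc k) e =
  cong₂ _+_ (∑bits-cong k (λ r → e (false ∷ r))) (∑bits-cong k (λ r → e (true ∷ r)))

∑□-double : ∀ k M f → ∑□ k (2 * M) f ≡ ∑□ k M (λ q → ∑bits k (λ r → f (pushBits r q)))
∑□-double zero    M f = refl
∑□-double (suc k) M f = begin
  ∑< (2 * M) (λ x → ∑□ k (2 * M) (λ p → f (x ∷ p)))
    ≡⟨ ∑<-double M _ ⟩
  ∑< M (λ y → ∑□ k (2 * M) (λ p → f (2 * y ∷ p)) + ∑□ k (2 * M) (λ p → f (1 + 2 * y ∷ p)))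
    ≡⟨ ∑<-cong M (λ y _ →
         trans (cong₂ _+_ (∑□-double k M _) (∑□-double k M _)) (sym (∑□-distrib-+ k M _ _))) ⟩
  ∑< M (λ y → ∑□ k M (λ q → ∑bits (suc k) (λ r → f (pushBits r (y ∷ q))))) ∎

∑bits-evenParity : ∀ (g : ℕ → ℕ) →
  ∑bits 4 (λ r → ⟦ not (bitParity r) ⟧ * g (bitCount r)) ≡ g 0 + 6 * g 2 + g 4
∑bits-evenParity g = tally (g 0) (g 2) (g 4)
  where
  -- One leaf per bit vector, in lexicographic order: odd vectors give 0,
  -- even ones give g of their weight.
  tally : ∀ a b c →
    (((1 * a + 0) + (0 + 1 * b)) + ((0 + 1 * b) + (1 * b + 0)))
      + (((0 + 1 * b) + (1 * b + 0)) + ((1 * b + 0) + (0 + 1 * c)))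
      ≡ a + 6 * b + c
  tally = solve-∀

isP : List ℕ → ℕ
isP p = ⟦ nimSum p ≡ᵇ 0 ⟧

isP-pushBits : ∀ r q → isP (pushBits r q) ≡ ⟦ not (bitParity r) ⟧ * isP q
isP-pushBits r q =
  trans (cong (λ n → ⟦ n ≡ᵇ 0 ⟧) (nimSum-pushBits r q)) (pushBit≡ᵇ0 (bitParity r) (nimSum q))
  where
  pushBit≡ᵇ0 : ∀ b n → ⟦ pushBit b n ≡ᵇ 0 ⟧ ≡ ⟦ not b ⟧ * ⟦ n ≡ᵇ 0 ⟧
  pushBit≡ᵇ0 true  n       = refl
  pushBit≡ᵇ0 false zero    = refl
  pushBit≡ᵇ0 false (suc n) = refl

countP : ℕ → ℕ
countP t = length (filterᵇ (λ p → nimSum p ≡ᵇ 0) (compositions 4 t))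

countP≡∑□ : ∀ {t} M → t < M → countP t ≡ ∑□ 4 M (λ p → isP p * ⟦ sum p ≡ᵇ t ⟧)
countP≡∑□ {t} M lt =
  trans (length-filterᵇ _ (compositions 4 t)) (sum-map-compositions 4 t M isP lt)

countP-via-halves : ∀ {t} M → t < 2 * M →
  countP t ≡ ∑□ 4 M (λ q → let g b = isP q * ⟦ b + 2 * sum q ≡ᵇ t ⟧ in g 0 + 6 * g 2 + g 4)
countP-via-halves {t} M lt = begin
  countP t
    ≡⟨ countP≡∑□ (2 * M) lt ⟩
  ∑□ 4 (2 * M) (λ p → isP p * ⟦ sum p ≡ᵇ t ⟧)
    ≡⟨ ∑□-double 4 M (λ p → isP p * ⟦ sum p ≡ᵇ t ⟧) ⟩
  ∑□ 4 M (λ q → ∑bits 4 (λ r → isP (pushBits r q) * ⟦ sum (pushBits r q) ≡ᵇ t ⟧))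
    ≡⟨ ∑□-cong 4 M (λ q → trans (∑bits-cong 4 (split q))
                                (∑bits-evenParity (λ b → isP q * ⟦ b + 2 * sum q ≡ᵇ t ⟧))) ⟩
  ∑□ 4 M (λ q → let g b = isP q * ⟦ b + 2 * sum q ≡ᵇ t ⟧ in g 0 + 6 * g 2 + g 4) ∎
  where
  split : ∀ q r → isP (pushBits r q) * ⟦ sum (pushBits r q) ≡ᵇ t ⟧
                ≡ ⟦ not (bitParity r) ⟧ * (isP q * ⟦ bitCount r + 2 * sum q ≡ᵇ t ⟧)
  split q r = trans (cong₂ (λ x s → x * ⟦ s ≡ᵇ t ⟧) (isP-pushBits r q) (sum-pushBits r q))
                    (*-assoc ⟦ not (bitParity r) ⟧ (isP q) _)

≡ᵇ-double : ∀ a b → (2 * a ≡ᵇ 2 * b) ≡ (a ≡ᵇ b)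
≡ᵇ-double zero    zero    = refl
≡ᵇ-double zero    (suc b) = refl
≡ᵇ-double (suc a) zero    = refl
≡ᵇ-double (suc a) (suc b) = trans (cong₂ _≡ᵇ_ (*-suc 2 a) (*-suc 2 b)) (≡ᵇ-double a b)

≡ᵇ-double-odd : ∀ a b → (2 * a ≡ᵇ 1 + 2 * b) ≡ false
≡ᵇ-double-odd zero    b       = refl
≡ᵇ-double-odd (suc a) zero    = cong (_≡ᵇ 1) (*-suc 2 a)
≡ᵇ-double-odd (suc a) (suc b) =
  trans (cong₂ _≡ᵇ_ (*-suc 2 a) (cong suc (*-suc 2 b))) (≡ᵇ-double-odd a b)

countP-odd : ∀ j → countP (1 + 2 * j) ≡ 0
countP-odd j =
  trans (countP-via-halves (suc t) (m≤m+n (suc t) _)) (∑□-zero 4 (suc t) (λ q →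
    cong₂ _+_ (cong₂ _+_ (vanish q 0) (cong (6 *_) (vanish q 1))) (vanish q 2)))
  where
  t = 1 + 2 * j
  vanish : ∀ q i → isP q * ⟦ 2 * i + 2 * sum q ≡ᵇ t ⟧ ≡ 0
  vanish q i = begin
    isP q * ⟦ 2 * i + 2 * sum q ≡ᵇ t ⟧ ≡⟨ cong (λ x → isP q * ⟦ x ≡ᵇ t ⟧) (*-distribˡ-+ 2 i (sum q)) ⟨
    isP q * ⟦ 2 * (i + sum q) ≡ᵇ t ⟧   ≡⟨ cong (λ b → isP q * ⟦ b ⟧) (≡ᵇ-double-odd (i + sum q) j) ⟩
    isP q * 0                          ≡⟨ *-zeroʳ (isP q) ⟩
    0                                  ∎

countP-double : ∀ m → countP (2 * (2 + m)) ≡ countP (2 + m) + 6 * countP (1 + m) + countP m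
countP-double m = begin
  countP (2 * u)
    ≡⟨ countP-via-halves (suc (2 * u)) (m≤m+n (suc (2 * u)) _) ⟩
  ∑□ 4 M (λ q → let g b = isP q * ⟦ b + 2 * sum q ≡ᵇ 2 * u ⟧ in g 0 + 6 * g 2 + g 4)
    ≡⟨ ∑□-cong 4 M (λ q → cong₂ _+_ (cong₂ _+_ (halve q 0) (cong (6 *_) (halve q 1))) (halve q 2)) ⟩
  ∑□ 4 M (λ q → P u q + 6 * P (1 + m) q + P m q)
    ≡⟨ ∑□-distrib-+ 4 M (λ q → P u q + 6 * P (1 + m) q) (P m) ⟩
  ∑□ 4 M (λ q → P u q + 6 * P (1 + m) q) + ∑□ 4 M (P m)
    ≡⟨ cong (_+ ∑□ 4 M (P m))
            (trans (∑□-distrib-+ 4 M (P u) (λ q → 6 * P (1 + m) q))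
                   (cong (∑□ 4 M (P u) +_) (∑□-*ˡ 4 M 6 (P (1 + m))))) ⟩
  ∑□ 4 M (P u) + 6 * ∑□ 4 M (P (1 + m)) + ∑□ 4 M (P m)
    ≡⟨ sym (cong₂ _+_ (cong₂ _+_ (countP≡∑□ M (below u ≤-refl))
                                (cong (6 *_) (countP≡∑□ M (below (1 + m) (n≤1+n _)))))
                     (countP≡∑□ M (below m (m≤n+m m 2)))) ⟩
  countP u + 6 * countP (1 + m) + countP m ∎
  where
  u = 2 + m
  M = suc (2 * u)
  P : ℕ → List ℕ → ℕ
  P v q = isP q * ⟦ sum q ≡ᵇ v ⟧
  below : ∀ v → v ≤ u → v < M
  below v le = s≤s (≤-trans le (m≤m+n u _))
  halve : ∀ q i → isP q * ⟦ 2 * i + 2 * sum q ≡ᵇ 2 * u ⟧ ≡ isP q * ⟦ i + sum q ≡ᵇ u ⟧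
  halve q i = cong (λ b → isP q * ⟦ b ⟧) (begin
    2 * i + 2 * sum q ≡ᵇ 2 * u   ≡⟨ cong (_≡ᵇ 2 * u) (*-distribˡ-+ 2 i (sum q)) ⟨
    2 * (i + sum q) ≡ᵇ 2 * u     ≡⟨ ≡ᵇ-double (i + sum q) u ⟩
    i + sum q ≡ᵇ u               ∎)

D₄-odd : ∀ n → D 4 (2 * n + 1) ≡ 6 * D 4 n
D₄-odd zero    = refl
D₄-odd (suc n) = begin
  D 4 (2 * suc n + 1)
    ≡⟨ cong (D 4) (+-comm (2 * suc n) 1) ⟩
  D 4 (1 + 2 * suc n)
    ≡⟨ cong (λ x → D 4 (1 + x)) (*-suc 2 n) ⟩
  countP (2 * (2 + (1 + 2 * n)))
    ≡⟨ countP-double (1 + 2 * n) ⟩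
  countP (2 + (1 + 2 * n)) + 6 * countP (2 + 2 * n) + countP (1 + 2 * n)
    ≡⟨ cong₂ _+_ (cong₂ _+_ (trans (cong (λ x → countP (1 + x)) (sym (*-suc 2 n)))
                                   (countP-odd (suc n)))
                            (cong (λ x → 6 * countP x) (sym (*-suc 2 n))))
                 (countP-odd n) ⟩
  0 + 6 * D 4 (suc n) + 0
    ≡⟨ +-identityʳ _ ⟩
  6 * D 4 (suc n) ∎

D₄-even : ∀ n → D 4 (2 * n + 2) ≡ D 4 (n + 1) + D 4 n
D₄-even n = begin
  D 4 (2 * n + 2)
    ≡⟨ cong (D 4) (+-comm (2 * n) 2) ⟩
  countP (2 * (2 + 2 * n))
    ≡⟨ countP-double (2 * n) ⟩
  countP (2 + 2 * n) + 6 * countP (1 + 2 * n) + D 4 n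
    ≡⟨ cong₂ (λ x y → x + 6 * y + D 4 n)
             (trans (cong countP (sym (*-suc 2 n))) (cong (D 4) (+-comm 1 n)))
             (countP-odd n) ⟩
  D 4 (n + 1) + 0 + D 4 n
    ≡⟨ cong (_+ D 4 n) (+-identityʳ _) ⟩
  D 4 (n + 1) + D 4 n ∎

lemma26 : (D 4 0 ≡ 1) × (D 4 1 ≡ 6)
        × ((n : ℕ) → D 4 (2 * n + 1) ≡ 6 * D 4 n)
        × ((n : ℕ) → D 4 (2 * n + 2) ≡ D 4 (n + 1) + D 4 n)
lemma26 = refl , refl , D₄-odd , D₄-even
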